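{- The planar cross-ratios satisfy $$\prod_{J\in\binom{[n]}{k}}u_J=1,$$ as an identity of Laurent monomials in the Plücker coordinates.
   Context: Fix $2\le k<n$, with indices mod $n$, and let $p_I$ ($I\in\binom{[n]}{k}$) be the Plücker coordinates. For $J\in\binom{[n]}{k}$, let $I_J=\{j\in J:j+1\notin J\}$ and $e_J=\sum_{j\in J}e_j\in\mathbb{R}^n$. The cubical array $C_J$ is the set of $k$-subsets $M$ with $e_M=e_J+\sum_{m\in A}(e_{m+1}-e_m)$ for some $A\subseteq I_J$. The planar cross-ratio is $$u_J=\prod_{M\in C_J}p_M^{(-1)^{|J\cap M|-k-1}}.$$ -}

module Defs where

open import Data.Bool using (Bool; true; false; if_then_else_; _∧_; not)
open import Data.Nat using (ℕ; zero; suc; _+_)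
open import Data.Nat.DivMod using (_mod_)
open import Data.Integer as ℤ using (ℤ; +_; -_)
open import Data.Fin using (Fin; toℕ)
import Data.Fin as F
open import Data.Fin.Subset using (Subset; _⊆_; _∩_; ∣_∣)
open import Data.Fin.Subset.Properties using (_⊆?_)
open import Data.List using (List; []; _∷_; map; _++_; allFin; foldr; filterᵇ)
open import Data.Bool.ListAction using (any)
open import Data.Vec using (Vec; lookup; tabulate)
import Data.Vec as V
open import Data.Vec.Properties using (≡-dec)
open import Relation.Nullary using (does)
import Data.Nat as N

sumℤ : List ℤ → ℤ
sumℤ = foldr ℤ._+_ (+ 0)

sucMod : ∀ {n} → Fin n → Fin n
sucMod {suc m} i = suc (toℕ i) mod suc m

allSubsets : ∀ n → List (Subset n)
allSubsets zero = V.[] ∷ []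
allSubsets (suc n) = map (true V.∷_) (allSubsets n) ++ map (false V.∷_) (allSubsets n)

kSubsets : ∀ n → ℕ → List (Subset n)
kSubsets n k = filterᵇ (λ J → does (∣ J ∣ N.≟ k)) (allSubsets n)

ind : Bool → ℤ
ind true = + 1
ind false = + 0

I : ∀ {n} → Subset n → Subset n
I J = tabulate λ j → lookup J j ∧ not (lookup J (sucMod j))

e : ∀ {n} → Subset n → Vec ℤ n
e J = tabulate λ i → ind (lookup J i)

shifted : ∀ {n} → Subset n → Subset n → Vec ℤ n
shifted {n} J A = tabulate λ i →
  ind (lookup J i) ℤ.+
  sumℤ (map (λ m → if lookup A m
                    then ind (does (sucMod m F.≟ i)) ℤ.- ind (does (m F.≟ i))
                    else + 0)
            (allFin n))

-- M ∈ C_J  :  ∃ A ⊆ I_J with e_M = e_J + Σ_{m∈A}(e_{m+1} - e_m)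
-- (decided by enumerating all subsets A of [n])
inCube : ∀ {n} → Subset n → Subset n → Bool
inCube {n} J M = any (λ A → does (A ⊆? I J) ∧ does (≡-dec ℤ._≟_ (e M) (shifted J A)))
                     (allSubsets n)

negOnePow : ℕ → ℤ
negOnePow zero = + 1
negOnePow (suc m) = - negOnePow m

-- exponent of p_M in u_J : (-1)^{|J∩M| - k - 1} if M ∈ C_J, else 0.
-- Since (-1)^{a-k-1} = (-1)^{a+k+1} for integers, we use the latter (ℕ-valued exponent).
uExp : ∀ {n} → ℕ → Subset n → Subset n → ℤ
uExp k J M = if inCube J M then negOnePow (∣ J ∩ M ∣ + k + 1) else + 0

-- exponent of p_M in ∏_{J ∈ ([n] choose k)} u_J
prodExp : ∀ n → ℕ → Subset n → ℤ
prodExp n k M = sumℤ (map (λ J → uExp k J M) (kSubsets n k))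

-- Choose s ∈ M with s - 1 ∉ M; it exists because 0 < |M| < n.  M lies in the cubical array C_J
-- exactly when every point of J ∖ M is followed by a point of M ∖ J and vice versa, since the
-- moving set A is forced to be J ∖ M.  Exchanging the entries of J at s - 1 and s preserves this
-- condition and |J|, and when M ∈ C_J it changes |J ∩ M| by one (if J takes the same value at
-- s - 1 and s, then M ∉ C_J).  So this swap is an involution on the k-subsets J that negates the
-- exponent of p_M in u_J, and the exponents cancel in the product.
module Submission where

open import Defs
open import Data.Bool using (Bool; true; false; if_then_else_; _∧_; not; T)
open import Data.Bool.Properties
  using (∧-zeroʳ; ∧-identityʳ; T-∧; not-involutive; not-¬; ¬-not) renaming (_≟_ to _≟ᵇ_)
open import Data.Empty using (⊥-elim)
open import Data.Fin using (Fin; zero; suc; toℕ; fromℕ; inject₁; _≟_)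
open import Data.Fin.Induction using (<-weakInduction; >-weakInduction)
open import Data.Fin.Permutation.Components using (transpose)
open import Data.Fin.Properties
  using (toℕ-injective; toℕ-fromℕ<; toℕ-fromℕ; toℕ-inject₁; toℕ<n; any?; suc-injective)
open import Data.Fin.Relation.Unary.Top using (view; ‵fromℕ; ‵inj₁)
open import Data.Fin.Subset using (Subset; _─_; _∩_; _⊆_; ∣_∣; ⊤; ⊥)
open import Data.Fin.Subset.Properties using (_⊆?_; p⊆q⇒∣p∣≤∣q∣; ∣⊤∣≡n; ∣⊥∣≡0)
open import Data.Integer using (ℤ; +_; -_; _+_; _-_)
import Data.Integer as ℤ
open import Data.Integer.Properties
  using (+-commutativeSemigroup; +-identityˡ; +-identityʳ; neg-distrib-+; neg-involutive)
open import Data.List using (List; []; _∷_; map; allFin; filterᵇ)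
open import Data.List.Properties using (map-cong)
open import Data.List.Membership.Propositional using (_∈_; lose)
open import Data.List.Membership.Propositional.Properties
  using (∈-map⁺; ∈-map⁻; ∈-++⁺ˡ; ∈-++⁺ʳ; ∈-allFin)
open import Data.List.Relation.Binary.Disjoint.Propositional using (Disjoint)
open import Data.List.Relation.Unary.All as All using (All; []; _∷_)
open import Data.List.Relation.Unary.AllPairs using ([]; _∷_)
open import Data.List.Relation.Unary.Any using (here; there; satisfied)
open import Data.List.Relation.Unary.Any.Properties using (any⁺; any⁻)
open import Data.List.Relation.Unary.Unique.Propositional using (Unique)
import Data.List.Relation.Unary.Unique.Propositional.Properties as Unique
open import Data.Nat as ℕ using (ℕ; zero; suc; _≤_; _<_; s≤s)
open import Data.Nat.DivMod using (_%_; n%n≡0; m<n⇒m%n≡m)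
open import Data.Nat.Properties using (<⇒≱; ≤-trans; module ≤-Reasoning)
open import Data.Product using (∃; _×_; _,_; proj₁; proj₂)
open import Data.Product.Function.NonDependent.Propositional using (_×-⇔_)
open import Data.Sum using (_⊎_; inj₁; inj₂; [_,_]′)
open import Data.Unit using (tt)
open import Data.Vec using ([]; _∷_; lookup; tabulate; _[_]≔_)
open import Data.Vec.Properties
  using (∷-injectiveʳ; lookup∘tabulate; lookup∘update; lookup∘update′; lookup-zipWith;
         []=⇒lookup; lookup⇒[]=; ≡-dec)
open import Data.Vec.Relation.Binary.Pointwise.Extensional using (ext; Pointwise-≡⇒≡)
open import Function using (_∘_; _⇔_; mk⇔; Equivalence)
open import Function.Construct.Composition using (_⇔-∘_)
open import Function.Construct.Symmetry using (⇔-sym)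
open import Relation.Binary.Definitions using (DecidableEquality)
open import Relation.Binary.PropositionalEquality
open import Relation.Nullary using (¬_; Dec; yes; no; does; _×-dec_; contradiction)
open import Relation.Nullary.Decidable using (dec-true; dec-false; does-⇔)
import Algebra.Properties.CommutativeSemigroup +-commutativeSemigroup as +-CS

private variable
  A B : Set
  n : ℕ

T-does⇔ : ∀ {P : Set} (P? : Dec P) → T (does P?) ⇔ P
T-does⇔ (yes p) = mk⇔ (λ _ → p) (λ _ → tt)
T-does⇔ (no ¬p) = mk⇔ (λ ()) ¬p

T-injective : ∀ {x y} → T x ⇔ T y → x ≡ y
T-injective {false} {false} _   = refl
T-injective {false} {true}  x⇔y = ⊥-elim (Equivalence.from x⇔y tt)
T-injective {true}  {false} x⇔y = ⊥-elim (Equivalence.to x⇔y tt)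
T-injective {true}  {true}  _   = refl

∧-not≡true : ∀ x y → x ∧ not y ≡ true → x ≡ true × y ≡ false
∧-not≡true true false _ = refl , refl

x≡-x⇒x≡0 : ∀ {x} → x ≡ - x → x ≡ + 0
x≡-x⇒x≡0 {+ zero} _ = refl

∑ : (A → ℤ) → List A → ℤ
∑ f xs = sumℤ (map f xs)

∑-cong : ∀ {f g : A → ℤ} → (∀ x → f x ≡ g x) → ∀ xs → ∑ f xs ≡ ∑ g xs
∑-cong f≗g xs = cong sumℤ (map-cong f≗g xs)

∑-vanishing : ∀ {f : A → ℤ} {xs} → All (λ x → f x ≡ + 0) xs → ∑ f xs ≡ + 0
∑-vanishing []           = refl
∑-vanishing (fx≡0 ∷ all) = cong₂ _+_ fx≡0 (∑-vanishing all)

∑-+ : ∀ (f g : A → ℤ) xs → ∑ (λ x → f x + g x) xs ≡ ∑ f xs + ∑ g xs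
∑-+ f g []       = refl
∑-+ f g (x ∷ xs) = trans (cong (_+_ (f x + g x)) (∑-+ f g xs)) (+-CS.interchange (f x) (g x) _ _)

∑-neg : ∀ (f : A → ℤ) xs → ∑ (λ x → - f x) xs ≡ - ∑ f xs
∑-neg f []       = refl
∑-neg f (x ∷ xs) = trans (cong (_+_ (- f x)) (∑-neg f xs)) (sym (neg-distrib-+ (f x) _))

∑-- : ∀ (f g : A → ℤ) xs → ∑ (λ x → f x - g x) xs ≡ ∑ f xs - ∑ g xs
∑-- f g xs = trans (∑-+ f (λ x → - g x) xs) (cong (_+_ (∑ f xs)) (∑-neg g xs))

∑-comm : ∀ (h : A → B → ℤ) xs ys → ∑ (λ x → ∑ (h x) ys) xs ≡ ∑ (λ y → ∑ (λ x → h x y) xs) ys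
∑-comm h []       ys = sym (∑-vanishing (All.universal (λ _ → refl) ys))
∑-comm h (x ∷ xs) ys = trans (cong (_+_ (∑ (h x) ys)) (∑-comm h xs ys)) (sym (∑-+ (h x) _ ys))

∑-filterᵇ : ∀ (p : A → Bool) (f : A → ℤ) xs →
  ∑ f (filterᵇ p xs) ≡ ∑ (λ x → if p x then f x else + 0) xs
∑-filterᵇ p f []       = refl
∑-filterᵇ p f (x ∷ xs) with p x
... | true  = cong (_+_ (f x)) (∑-filterᵇ p f xs)
... | false = trans (∑-filterᵇ p f xs) (sym (+-identityˡ _))

∑-delta : ∀ {f : A → ℤ} {x xs} → Unique xs → x ∈ xs → (∀ y → y ≢ x → f y ≡ + 0) → ∑ f xs ≡ f x
∑-delta {f = f} (x∉xs ∷ _) (here refl) f≡0 =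
  trans (cong (_+_ (f _)) (∑-vanishing (All.map (λ x≢y → f≡0 _ (x≢y ∘ sym)) x∉xs))) (+-identityʳ _)
∑-delta (y∉xs ∷ unique) (there x∈xs) f≡0 =
  trans (cong₂ _+_ (f≡0 _ (All.lookup y∉xs x∈xs)) (∑-delta unique x∈xs f≡0)) (+-identityˡ _)

module _ (_≟_ : DecidableEquality A) {xs : List A} (unique : Unique xs) (complete : ∀ x → x ∈ xs)
         (σ σ⁻¹ : A → A) (σ⁻¹∘σ : ∀ x → σ⁻¹ (σ x) ≡ x) (σ∘σ⁻¹ : ∀ x → σ (σ⁻¹ x) ≡ x)
         where

  ∑-reindex : ∀ (f : A → ℤ) → ∑ (f ∘ σ) xs ≡ ∑ f xs
  ∑-reindex f = begin
    ∑ (f ∘ σ) xs                        ≡⟨ ∑-cong ∑-graph-row xs ⟨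
    ∑ (λ x → ∑ (graph x) xs) xs         ≡⟨ ∑-comm graph xs xs ⟩
    ∑ (λ y → ∑ (λ x → graph x y) xs) xs ≡⟨ ∑-cong ∑-graph-column xs ⟩
    ∑ f xs                              ∎
    where
    open ≡-Reasoning
    graph : A → A → ℤ
    graph x y = if does (y ≟ σ x) then f y else + 0
    graph-on : ∀ {x y} → y ≡ σ x → graph x y ≡ f y
    graph-on {x} {y} y≡σx rewrite dec-true (y ≟ σ x) y≡σx = refl
    graph-off : ∀ {x y} → y ≢ σ x → graph x y ≡ + 0
    graph-off {x} {y} y≢σx rewrite dec-false (y ≟ σ x) y≢σx = refl
    σ⁻¹-unique : ∀ {x y} → x ≢ σ⁻¹ y → y ≢ σ x
    σ⁻¹-unique x≢σ⁻¹y y≡σx = x≢σ⁻¹y (trans (sym (σ⁻¹∘σ _)) (cong σ⁻¹ (sym y≡σx)))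
    ∑-graph-row : ∀ x → ∑ (graph x) xs ≡ f (σ x)
    ∑-graph-row x = trans (∑-delta unique (complete (σ x)) (λ _ → graph-off)) (graph-on refl)
    ∑-graph-column : ∀ y → ∑ (λ x → graph x y) xs ≡ f y
    ∑-graph-column y = trans (∑-delta unique (complete (σ⁻¹ y)) (λ _ → graph-off ∘ σ⁻¹-unique))
                             (graph-on (sym (σ∘σ⁻¹ y)))

predMod : Fin n → Fin n
predMod {suc m} zero    = fromℕ m
predMod {suc m} (suc i) = inject₁ i

toℕ-sucMod : ∀ {m} (i : Fin (suc m)) → toℕ (sucMod i) ≡ suc (toℕ i) % suc m
toℕ-sucMod i = toℕ-fromℕ< _

sucMod-fromℕ : ∀ m → sucMod (fromℕ m) ≡ zero
sucMod-fromℕ m = toℕ-injective (begin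
  toℕ (sucMod (fromℕ m))      ≡⟨ toℕ-sucMod (fromℕ m) ⟩
  suc (toℕ (fromℕ m)) % suc m ≡⟨ cong (λ x → suc x % suc m) (toℕ-fromℕ m) ⟩
  suc m % suc m               ≡⟨ n%n≡0 (suc m) ⟩
  0                           ∎)
  where open ≡-Reasoning

sucMod-inject₁ : ∀ {m} (i : Fin m) → sucMod (inject₁ i) ≡ suc i
sucMod-inject₁ {m} i = toℕ-injective (begin
  toℕ (sucMod (inject₁ i))      ≡⟨ toℕ-sucMod (inject₁ i) ⟩
  suc (toℕ (inject₁ i)) % suc m ≡⟨ cong (λ x → suc x % suc m) (toℕ-inject₁ i) ⟩
  suc (toℕ i) % suc m           ≡⟨ m<n⇒m%n≡m (s≤s (toℕ<n i)) ⟩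
  suc (toℕ i)                   ∎)
  where open ≡-Reasoning

sucMod-predMod : ∀ (i : Fin n) → sucMod (predMod i) ≡ i
sucMod-predMod {suc m} zero    = sucMod-fromℕ m
sucMod-predMod         (suc i) = sucMod-inject₁ i

predMod-sucMod : ∀ (i : Fin n) → predMod (sucMod i) ≡ i
predMod-sucMod {suc m} i with view i
... | ‵fromℕ  = cong predMod (sucMod-fromℕ m)
... | ‵inj₁ _ = cong predMod (sucMod-inject₁ _)

sucMod-injective : ∀ {i j : Fin n} → sucMod i ≡ sucMod j → i ≡ j
sucMod-injective {i = i} {j} eq =
  trans (sym (predMod-sucMod i)) (trans (cong predMod eq) (predMod-sucMod j))

-- Walking down from any member reaches 0, which wraps around to the top; walking down from the
-- top covers everything.
predMod-closed⇒trivial : ∀ {m} (M : Subset (suc m)) →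
  (∀ s → lookup M s ≡ true → lookup M (predMod s) ≡ true) →
  (∀ i → lookup M i ≡ true) ⊎ (∀ i → lookup M i ≡ false)
predMod-closed⇒trivial M closed with lookup M zero in M₀
... | true  = inj₁ (>-weakInduction (λ i → lookup M i ≡ true) (closed zero M₀) (λ i → closed (suc i)))
... | false = inj₂ λ i → ¬-not λ Mᵢ → true≢false (trans (sym (reaches-zero i Mᵢ)) M₀)
  where
  reaches-zero : ∀ i → lookup M i ≡ true → lookup M zero ≡ true
  reaches-zero = <-weakInduction _ (λ M₀ → M₀) (λ i ih M-suc-i → ih (closed (suc i) M-suc-i))
  true≢false : true ≢ false
  true≢false ()

∃-risingEdge : ∀ {m} (M : Subset (suc m)) →
  ¬ (∀ i → lookup M i ≡ true) → ¬ (∀ i → lookup M i ≡ false) →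
  ∃ λ s → lookup M s ≡ true × lookup M (predMod s) ≡ false
∃-risingEdge M not-full not-empty
  with any? (λ s → (lookup M s ≟ᵇ true) ×-dec (lookup M (predMod s) ≟ᵇ false))
... | yes edge   = edge
... | no no-edge = ⊥-elim ([ not-full , not-empty ]′ (predMod-closed⇒trivial M closed))
  where
  closed : ∀ s → lookup M s ≡ true → lookup M (predMod s) ≡ true
  closed s Ms = ¬-not (λ M-pred-s → no-edge (s , Ms , M-pred-s))

transpose-matchˡ : ∀ (i j : Fin n) → transpose i j i ≡ j
transpose-matchˡ i j rewrite dec-true (i ≟ i) refl = refl

transpose-matchʳ : ∀ (i j : Fin n) → transpose i j j ≡ i
transpose-matchʳ i j with j ≟ i
... | yes j≡i = j≡i
... | no  _   rewrite dec-true (j ≟ j) refl = refl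

transpose-noMatch : ∀ {i j k : Fin n} → k ≢ i → k ≢ j → transpose i j k ≡ k
transpose-noMatch {i = i} {j} {k} k≢i k≢j
  rewrite dec-false (k ≟ i) k≢i | dec-false (k ≟ j) k≢j = refl

transpose-involutive : ∀ (i j k : Fin n) → transpose i j (transpose i j k) ≡ k
transpose-involutive i j k = by-cases (k ≟ i) (k ≟ j)
  where
  twice : ∀ {k′} → transpose i j k ≡ k′ → transpose i j k′ ≡ k → transpose i j (transpose i j k) ≡ k
  twice first second = trans (cong (transpose i j) first) second
  by-cases : Dec (k ≡ i) → Dec (k ≡ j) → transpose i j (transpose i j k) ≡ k
  by-cases (yes refl) _          = twice (transpose-matchˡ i j) (transpose-matchʳ i j)
  by-cases (no _)     (yes refl) = twice (transpose-matchʳ i j) (transpose-matchˡ i j)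
  by-cases (no k≢i)   (no k≢j)   = twice (transpose-noMatch k≢i k≢j) (transpose-noMatch k≢i k≢j)

∈-allSubsets : ∀ (p : Subset n) → p ∈ allSubsets n
∈-allSubsets []          = here refl
∈-allSubsets (true ∷ p)  = ∈-++⁺ˡ (∈-map⁺ (true ∷_) (∈-allSubsets p))
∈-allSubsets (false ∷ p) = ∈-++⁺ʳ _ (∈-map⁺ (false ∷_) (∈-allSubsets p))

allSubsets-unique : ∀ n → Unique (allSubsets n)
allSubsets-unique zero    = All.[] ∷ []
allSubsets-unique (suc n) = Unique.++⁺ (with-head true) (with-head false) heads-differ
  where
  with-head : ∀ b → Unique (map (b ∷_) (allSubsets n))
  with-head b = Unique.map⁺ ∷-injectiveʳ (allSubsets-unique n)
  heads-differ : Disjoint (map (true ∷_) (allSubsets n)) (map (false ∷_) (allSubsets n))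
  heads-differ (p∈ , q∈) with ∈-map⁻ (true ∷_) p∈ | ∈-map⁻ (false ∷_) q∈
  ... | _ , _ , refl | _ , _ , ()

lookup-─ : ∀ (p q : Subset n) i → lookup (p ─ q) i ≡ lookup p i ∧ not (lookup q i)
lookup-─ (x ∷ _) (true  ∷ _) zero    = sym (∧-zeroʳ x)
lookup-─ (x ∷ _) (false ∷ _) zero    = sym (∧-identityʳ x)
lookup-─ (_ ∷ p) (_     ∷ q) (suc i) = lookup-─ p q i

∣p∣≡1+∣q∣ : ∀ (p q : Subset n) i → (∀ j → j ≢ i → lookup p j ≡ lookup q j) →
  lookup p i ≡ true → lookup q i ≡ false → ∣ p ∣ ≡ suc ∣ q ∣
∣p∣≡1+∣q∣ (true ∷ p) (false ∷ q) zero agree refl refl =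
  cong (λ r → suc ∣ r ∣) (Pointwise-≡⇒≡ {xs = p} {q} (ext λ j → agree (suc j) λ ()))
∣p∣≡1+∣q∣ (x ∷ p) (y ∷ q) (suc i) agree pᵢ qᵢ with refl ← agree zero (λ ()) = step x
  where
  tail : ∣ p ∣ ≡ suc ∣ q ∣
  tail = ∣p∣≡1+∣q∣ p q i (λ j j≢i → agree (suc j) (j≢i ∘ suc-injective)) pᵢ qᵢ
  step : ∀ x → ∣ x ∷ p ∣ ≡ suc ∣ x ∷ q ∣
  step true  = cong suc tail
  step false = tail

swap : Fin n → Fin n → Subset n → Subset n
swap i j J = tabulate (lookup J ∘ transpose i j)

lookup-swap : ∀ i j (J : Subset n) k → lookup (swap i j J) k ≡ lookup J (transpose i j k)
lookup-swap i j J k = lookup∘tabulate _ k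

swap-involutive : ∀ i j (J : Subset n) → swap i j (swap i j J) ≡ J
swap-involutive i j J = Pointwise-≡⇒≡ (ext λ k → begin
  lookup (swap i j (swap i j J)) k         ≡⟨ lookup-swap i j (swap i j J) k ⟩
  lookup (swap i j J) (transpose i j k)    ≡⟨ lookup-swap i j J (transpose i j k) ⟩
  lookup J (transpose i j (transpose i j k)) ≡⟨ cong (lookup J) (transpose-involutive i j k) ⟩
  lookup J k                               ∎)
  where open ≡-Reasoning

lookup-shifted : ∀ (J A : Subset n) i →
  lookup (shifted J A) i ≡ ind (lookup J i) + (ind (lookup A (predMod i)) - ind (lookup A i))
lookup-shifted {n} J A i = trans (lookup∘tabulate _ i) (cong (_+_ (ind (lookup J i))) (begin
  ∑ moved (allFin n)                                   ≡⟨ ∑-cong split (allFin n) ⟩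
  ∑ (λ m → at (predMod i) m - at i m) (allFin n)       ≡⟨ ∑-- (at (predMod i)) (at i) (allFin n) ⟩
  ∑ (at (predMod i)) (allFin n) - ∑ (at i) (allFin n)  ≡⟨ cong₂ _-_ (∑-at (predMod i)) (∑-at i) ⟩
  ind (lookup A (predMod i)) - ind (lookup A i)        ∎))
  where
  open ≡-Reasoning
  moved : Fin n → ℤ
  moved m = if lookup A m then ind (does (sucMod m ≟ i)) - ind (does (m ≟ i)) else + 0
  at : Fin n → Fin n → ℤ
  at c m = ind (lookup A m ∧ does (m ≟ c))
  guard-- : ∀ b x y → (if b then ind x - ind y else + 0) ≡ ind (b ∧ x) - ind (b ∧ y)
  guard-- true  x y = refl
  guard-- false x y = refl
  sucMod≡⇔ : ∀ {m} → sucMod m ≡ i ⇔ m ≡ predMod i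
  sucMod≡⇔ {m} = mk⇔ (λ eq → trans (sym (predMod-sucMod m)) (cong predMod eq))
                     (λ eq → trans (cong sucMod eq) (sucMod-predMod i))
  split : ∀ m → moved m ≡ at (predMod i) m - at i m
  split m = trans (guard-- (lookup A m) _ _) (cong (λ x → ind (lookup A m ∧ x) - at i m)
                                                  (does-⇔ sucMod≡⇔ (sucMod m ≟ i) (m ≟ predMod i)))
  ∑-at : ∀ c → ∑ (at c) (allFin n) ≡ ind (lookup A c)
  ∑-at c = trans (∑-delta (Unique.allFin⁺ n) (∈-allFin c) off) on
    where
    off : ∀ m → m ≢ c → at c m ≡ + 0
    off m m≢c rewrite dec-false (m ≟ c) m≢c | ∧-zeroʳ (lookup A m) = refl
    on : at c c ≡ ind (lookup A c)
    on rewrite dec-true (c ≟ c) refl | ∧-identityʳ (lookup A c) = refl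

-- M ∈ C_J in intrinsic form (see inCube⇔ShiftsTo): the points of J ∖ M are exactly those moved
-- one step forward, and they land on M ∖ J.
ShiftsTo : Subset n → Subset n → Set
ShiftsTo J M = ∀ i → lookup (J ─ M) i ≡ lookup (M ─ J) (sucMod i)

-- Coordinate i of e_M = e_J + Σ_{m∈A} (e_{m+1} - e_m), where a′ = [i - 1 ∈ A] and a = [i ∈ A]:
-- together with A ⊆ I_J it forces A = J ∖ M at i and A + 1 = M ∖ J at i.
coordinate⇒moves : ∀ m j a′ a → ind m ≡ ind j + (ind a′ - ind a) →
  (a′ ≡ true → j ≡ false) → (a ≡ true → j ≡ true) → a ≡ j ∧ not m × a′ ≡ m ∧ not j
coordinate⇒moves _     true  true  _     _  a′⇒¬j _   with () ← a′⇒¬j refl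
coordinate⇒moves _     false _     true  _  _     a⇒j with () ← a⇒j refl
coordinate⇒moves false true  false true  _  _     _   = refl , refl
coordinate⇒moves true  true  false false _  _     _   = refl , refl
coordinate⇒moves true  false true  false _  _     _   = refl , refl
coordinate⇒moves false false false false _  _     _   = refl , refl
coordinate⇒moves true  true  false true  () _     _
coordinate⇒moves false true  false false () _     _
coordinate⇒moves true  false false false () _     _
coordinate⇒moves false false true  false () _     _

moves⇒coordinate : ∀ m j → ind m ≡ ind j + (ind (m ∧ not j) - ind (j ∧ not m))
moves⇒coordinate true  true  = refl
moves⇒coordinate true  false = refl
moves⇒coordinate false true  = refl
moves⇒coordinate false false = refl

module _ {J M : Subset n} where

  shiftedBy⇒ShiftsTo : ∀ {A} → A ⊆ I J → e M ≡ shifted J A → ShiftsTo J M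
  shiftedBy⇒ShiftsTo {A} A⊆IJ eM≡shifted i = begin
    lookup (J ─ M) i              ≡⟨ proj₁ (forced i) ⟨
    lookup A i                    ≡⟨ cong (lookup A) (predMod-sucMod i) ⟨
    lookup A (predMod (sucMod i)) ≡⟨ proj₂ (forced (sucMod i)) ⟩
    lookup (M ─ J) (sucMod i)     ∎
    where
    open ≡-Reasoning
    moves : ∀ q → lookup A q ≡ true → lookup J q ≡ true × lookup J (sucMod q) ≡ false
    moves q Aq = ∧-not≡true _ _ (trans (sym (lookup∘tabulate _ q)) ([]=⇒lookup (A⊆IJ (lookup⇒[]= q A Aq))))
    coordinate : ∀ p → ind (lookup M p) ≡ ind (lookup J p) + (ind (lookup A (predMod p)) - ind (lookup A p))
    coordinate p = trans (sym (lookup∘tabulate _ p))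
                         (trans (cong (λ v → lookup v p) eM≡shifted) (lookup-shifted J A p))
    forced : ∀ p → lookup A p ≡ lookup (J ─ M) p × lookup A (predMod p) ≡ lookup (M ─ J) p
    forced p rewrite lookup-─ J M p | lookup-─ M J p =
      coordinate⇒moves _ _ _ _ (coordinate p)
        (λ Aₚ₋₁ → trans (cong (lookup J) (sym (sucMod-predMod p))) (proj₂ (moves (predMod p) Aₚ₋₁)))
        (λ Aₚ → proj₁ (moves p Aₚ))

  ShiftsTo⇒shiftedBy : ShiftsTo J M → (J ─ M) ⊆ I J × e M ≡ shifted J (J ─ M)
  ShiftsTo⇒shiftedBy shifts = J─M⊆IJ , Pointwise-≡⇒≡ (ext coordinate)
    where
    open ≡-Reasoning
    J─M⊆IJ : (J ─ M) ⊆ I J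
    J─M⊆IJ {q} q∈J─M = lookup⇒[]= q (I J) (begin
      lookup (I J) q                          ≡⟨ lookup∘tabulate _ q ⟩
      lookup J q ∧ not (lookup J (sucMod q))  ≡⟨ cong₂ (λ x y → x ∧ not y) J-q J-q+1 ⟩
      true                                    ∎)
      where
      J─M-q : lookup (J ─ M) q ≡ true
      J─M-q = []=⇒lookup q∈J─M
      J-q : lookup J q ≡ true
      J-q = proj₁ (∧-not≡true (lookup J q) (lookup M q) (trans (sym (lookup-─ J M q)) J─M-q))
      J-q+1 : lookup J (sucMod q) ≡ false
      J-q+1 = proj₂ (∧-not≡true (lookup M (sucMod q)) (lookup J (sucMod q))
                                (trans (sym (lookup-─ M J (sucMod q))) (trans (sym (shifts q)) J─M-q)))
    coordinate : ∀ p → lookup (e M) p ≡ lookup (shifted J (J ─ M)) p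
    coordinate p = begin
      lookup (e M) p
        ≡⟨ lookup∘tabulate _ p ⟩
      ind (lookup M p)
        ≡⟨ moves⇒coordinate (lookup M p) (lookup J p) ⟩
      ind (lookup J p) + (ind (lookup M p ∧ not (lookup J p)) - ind (lookup J p ∧ not (lookup M p)))
        ≡⟨ cong₂ (λ x y → ind (lookup J p) + (ind x - ind y)) arrived (sym (lookup-─ J M p)) ⟩
      ind (lookup J p) + (ind (lookup (J ─ M) (predMod p)) - ind (lookup (J ─ M) p))
        ≡⟨ lookup-shifted J (J ─ M) p ⟨
      lookup (shifted J (J ─ M)) p
        ∎
      where
      arrived : lookup M p ∧ not (lookup J p) ≡ lookup (J ─ M) (predMod p)
      arrived = begin
        lookup M p ∧ not (lookup J p)      ≡⟨ lookup-─ M J p ⟨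
        lookup (M ─ J) p                   ≡⟨ cong (lookup (M ─ J)) (sucMod-predMod p) ⟨
        lookup (M ─ J) (sucMod (predMod p)) ≡⟨ shifts (predMod p) ⟨
        lookup (J ─ M) (predMod p)         ∎

inCube⇔ShiftsTo : ∀ (J M : Subset n) → T (inCube J M) ⇔ ShiftsTo J M
inCube⇔ShiftsTo {n} J M = mk⇔ cube⇒shifts shifts⇒cube
  where
  witnesses : Subset n → Bool
  witnesses A = does (A ⊆? I J) ∧ does (≡-dec ℤ._≟_ (e M) (shifted J A))
  witnesses⇔ : ∀ A → T (witnesses A) ⇔ (A ⊆ I J × e M ≡ shifted J A)
  witnesses⇔ A = (T-does⇔ (A ⊆? I J) ×-⇔ T-does⇔ (≡-dec ℤ._≟_ (e M) (shifted J A))) ⇔-∘ T-∧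
  cube⇒shifts : T (inCube J M) → ShiftsTo J M
  cube⇒shifts cube with satisfied (any⁻ witnesses (allSubsets n) cube)
  ... | A , witness = let A⊆IJ , eM≡ = Equivalence.to (witnesses⇔ A) witness in
                      shiftedBy⇒ShiftsTo {J = J} {M} A⊆IJ eM≡
  shifts⇒cube : ShiftsTo J M → T (inCube J M)
  shifts⇒cube shifts = any⁺ witnesses (lose (∈-allSubsets (J ─ M))
    (Equivalence.from (witnesses⇔ (J ─ M)) (ShiftsTo⇒shiftedBy {J = J} {M} shifts)))

exponentTerm : ℕ → Bool → Bool → ℕ → ℤ
exponentTerm k sized member x = if sized then (if member then negOnePow (x ℕ.+ k ℕ.+ 1) else + 0) else + 0

exponentTerm-suc : ∀ k sized member x → exponentTerm k sized member x ≡ - exponentTerm k sized member (suc x)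
exponentTerm-suc k true  true  x = sym (neg-involutive _)
exponentTerm-suc k true  false x = refl
exponentTerm-suc k false _     x = refl

exponentTerm-outside : ∀ k sized {member} x → ¬ T member → exponentTerm k sized member x ≡ + 0
exponentTerm-outside k sized {true}  x ¬T = ⊥-elim (¬T tt)
exponentTerm-outside k true  {false} x ¬T = refl
exponentTerm-outside k false {false} x ¬T = refl

module Cancellation {n} (M : Subset n) (s : Fin n)
                    (s∈M : lookup M s ≡ true) (a∉M : lookup M (predMod s) ≡ false) where

  a : Fin n
  a = predMod s

  σ : Subset n → Subset n
  σ = swap a s

  a≢s : a ≢ s
  a≢s a≡s with () ← trans (sym a∉M) (trans (cong (lookup M) a≡s) s∈M)

  lookup-σ-a : ∀ J → lookup (σ J) a ≡ lookup J s
  lookup-σ-a J = trans (lookup-swap a s J a) (cong (lookup J) (transpose-matchˡ a s))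

  lookup-σ-s : ∀ J → lookup (σ J) s ≡ lookup J a
  lookup-σ-s J = trans (lookup-swap a s J s) (cong (lookup J) (transpose-matchʳ a s))

  lookup-σ-other : ∀ J {k} → k ≢ a → k ≢ s → lookup (σ J) k ≡ lookup J k
  lookup-σ-other J k≢a k≢s = trans (lookup-swap a s J _) (cong (lookup J) (transpose-noMatch k≢a k≢s))

  leaves-at-a : ∀ X → lookup (X ─ M) a ≡ lookup X a
  leaves-at-a X rewrite lookup-─ X M a | a∉M = ∧-identityʳ (lookup X a)

  arrives-at-s : ∀ X → lookup (M ─ X) (sucMod a) ≡ not (lookup X s)
  arrives-at-s X rewrite sucMod-predMod s | lookup-─ M X s | s∈M = refl

  -- Since s ∈ M and a ∉ M, swapping J at a and s changes J ∖ M only at a and M ∖ J only at s.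
  leaves-σ : ∀ J k → k ≢ a → lookup (σ J ─ M) k ≡ lookup (J ─ M) k
  leaves-σ J k k≢a with k ≟ s
  ... | yes refl = trans (leaves-at-s (σ J)) (sym (leaves-at-s J))
    where
    leaves-at-s : ∀ X → lookup (X ─ M) s ≡ false
    leaves-at-s X rewrite lookup-─ X M s | s∈M = ∧-zeroʳ (lookup X s)
  ... | no k≢s rewrite lookup-─ (σ J) M k | lookup-─ J M k | lookup-σ-other J k≢a k≢s = refl

  arrives-σ : ∀ J k → k ≢ s → lookup (M ─ σ J) k ≡ lookup (M ─ J) k
  arrives-σ J k k≢s with k ≟ a
  ... | yes refl = trans (arrives-at-a (σ J)) (sym (arrives-at-a J))
    where
    arrives-at-a : ∀ X → lookup (M ─ X) a ≡ false
    arrives-at-a X rewrite lookup-─ M X a | a∉M = refl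
  ... | no k≢a rewrite lookup-─ M (σ J) k | lookup-─ M J k | lookup-σ-other J k≢a k≢s = refl

  ShiftsTo⇒a≡¬s : ∀ {X} → ShiftsTo X M → lookup X a ≡ not (lookup X s)
  ShiftsTo⇒a≡¬s {X} shifts = trans (sym (leaves-at-a X)) (trans (shifts a) (arrives-at-s X))

  -- At a the condition reads J a ≡ not (J s), which is symmetric in a and s; at every other k
  -- neither side changes, as sucMod k ≢ s.
  ShiftsTo-σ : ∀ {J} → ShiftsTo J M → ShiftsTo (σ J) M
  ShiftsTo-σ {J} shifts k with k ≟ a
  ... | yes refl = begin
    lookup (σ J ─ M) a            ≡⟨ leaves-at-a (σ J) ⟩
    lookup (σ J) a                ≡⟨ lookup-σ-a J ⟩
    lookup J s                    ≡⟨ not-involutive (lookup J s) ⟨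
    not (not (lookup J s))        ≡⟨ cong not (ShiftsTo⇒a≡¬s shifts) ⟨
    not (lookup J a)              ≡⟨ cong not (lookup-σ-s J) ⟨
    not (lookup (σ J) s)          ≡⟨ arrives-at-s (σ J) ⟨
    lookup (M ─ σ J) (sucMod a)   ∎
    where open ≡-Reasoning
  ... | no k≢a = begin
    lookup (σ J ─ M) k            ≡⟨ leaves-σ J k k≢a ⟩
    lookup (J ─ M) k              ≡⟨ shifts k ⟩
    lookup (M ─ J) (sucMod k)     ≡⟨ arrives-σ J (sucMod k) (k≢a ∘ sucMod≡s⇒≡a) ⟨
    lookup (M ─ σ J) (sucMod k)   ∎
    where
    open ≡-Reasoning
    sucMod≡s⇒≡a : sucMod k ≡ s → k ≡ a
    sucMod≡s⇒≡a eq = sucMod-injective (trans eq (sym (sucMod-predMod s)))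

  inCube-σ : ∀ J → inCube (σ J) M ≡ inCube J M
  inCube-σ J = T-injective (⇔-sym (inCube⇔ShiftsTo J M) ⇔-∘ (ShiftsTo-σ⇔ ⇔-∘ inCube⇔ShiftsTo (σ J) M))
    where
    ShiftsTo-σ⇔ : ShiftsTo (σ J) M ⇔ ShiftsTo J M
    ShiftsTo-σ⇔ = mk⇔ (subst (λ X → ShiftsTo X M) (swap-involutive a s J) ∘ ShiftsTo-σ) ShiftsTo-σ

  ¬inCube : ∀ X → lookup X a ≡ lookup X s → ¬ T (inCube X M)
  ¬inCube X Xa≡Xs = not-¬ Xa≡Xs ∘ ShiftsTo⇒a≡¬s ∘ Equivalence.to (inCube⇔ShiftsTo X M)

  module _ (J : Subset n) (J-a : lookup J a ≡ false) (J-s : lookup J s ≡ true) where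

    ∣σJ∣≡∣J∣ : ∣ σ J ∣ ≡ ∣ J ∣
    ∣σJ∣≡∣J∣ = trans (∣p∣≡1+∣q∣ (σ J) J-s̸ a agree-off-a (trans (lookup-σ-a J) J-s) J-s̸-a)
                    (sym (∣p∣≡1+∣q∣ J J-s̸ s agree-off-s J-s (lookup∘update s J false)))
      where
      J-s̸ : Subset n
      J-s̸ = J [ s ]≔ false
      J-s̸-a : lookup J-s̸ a ≡ false
      J-s̸-a = trans (lookup∘update′ a≢s J false) J-a
      agree-off-s : ∀ k → k ≢ s → lookup J k ≡ lookup J-s̸ k
      agree-off-s k k≢s = sym (lookup∘update′ k≢s J false)
      agree-off-a : ∀ k → k ≢ a → lookup (σ J) k ≡ lookup J-s̸ k
      agree-off-a k k≢a with k ≟ s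
      ... | yes refl = trans (lookup-σ-s J) (trans J-a (sym (lookup∘update s J false)))
      ... | no k≢s   = trans (lookup-σ-other J k≢a k≢s) (agree-off-s k k≢s)

    ∣J∩M∣≡1+∣σJ∩M∣ : ∣ J ∩ M ∣ ≡ suc ∣ σ J ∩ M ∣
    ∣J∩M∣≡1+∣σJ∩M∣ =
      ∣p∣≡1+∣q∣ (J ∩ M) (σ J ∩ M) s agree-off-s (at-s J J-s) (at-s (σ J) (trans (lookup-σ-s J) J-a))
      where
      lookup-∩M : ∀ X k → lookup (X ∩ M) k ≡ lookup X k ∧ lookup M k
      lookup-∩M X k = lookup-zipWith _∧_ k X M
      at-s : ∀ X {b} → lookup X s ≡ b → lookup (X ∩ M) s ≡ b
      at-s X {b} X-s rewrite lookup-∩M X s | X-s | s∈M = ∧-identityʳ b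
      agree-off-s : ∀ k → k ≢ s → lookup (J ∩ M) k ≡ lookup (σ J ∩ M) k
      agree-off-s k k≢s with k ≟ a
      ... | yes refl rewrite lookup-∩M J a | lookup-∩M (σ J) a | a∉M = trans (∧-zeroʳ _) (sym (∧-zeroʳ _))
      ... | no k≢a   rewrite lookup-∩M J k | lookup-∩M (σ J) k | lookup-σ-other J k≢a k≢s = refl

  sizedExp : ℕ → Subset n → ℤ
  sizedExp k J = if does (∣ J ∣ ℕ.≟ k) then uExp k J M else + 0

  sizedExp-σ-flip : ∀ k J → lookup J a ≡ false → lookup J s ≡ true → sizedExp k (σ J) ≡ - sizedExp k J
  sizedExp-σ-flip k J J-a J-s = begin
    sizedExp k (σ J)
      ≡⟨⟩
    exponentTerm k (does (∣ σ J ∣ ℕ.≟ k)) (inCube (σ J) M) ∣ σ J ∩ M ∣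
      ≡⟨ cong₂ (λ sized member → exponentTerm k sized member ∣ σ J ∩ M ∣)
               (cong (λ c → does (c ℕ.≟ k)) (∣σJ∣≡∣J∣ J J-a J-s)) (inCube-σ J) ⟩
    exponentTerm k sized member ∣ σ J ∩ M ∣
      ≡⟨ exponentTerm-suc k sized member ∣ σ J ∩ M ∣ ⟩
    - exponentTerm k sized member (suc ∣ σ J ∩ M ∣)
      ≡⟨ cong (λ c → - exponentTerm k sized member c) (∣J∩M∣≡1+∣σJ∩M∣ J J-a J-s) ⟨
    - sizedExp k J
      ∎
    where
    open ≡-Reasoning
    sized member : Bool
    sized  = does (∣ J ∣ ℕ.≟ k)
    member = inCube J M

  sizedExp-σ-fixed : ∀ k J → lookup J a ≡ lookup J s → sizedExp k (σ J) ≡ - sizedExp k J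
  sizedExp-σ-fixed k J J-a≡J-s = trans (vanishes (σ J) σJ-a≡σJ-s) (cong -_ (sym (vanishes J J-a≡J-s)))
    where
    vanishes : ∀ X → lookup X a ≡ lookup X s → sizedExp k X ≡ + 0
    vanishes X Xa≡Xs = exponentTerm-outside k (does (∣ X ∣ ℕ.≟ k)) ∣ X ∩ M ∣ (¬inCube X Xa≡Xs)
    σJ-a≡σJ-s : lookup (σ J) a ≡ lookup (σ J) s
    σJ-a≡σJ-s = trans (lookup-σ-a J) (trans (sym J-a≡J-s) (sym (lookup-σ-s J)))

  sizedExp-σ : ∀ k J → sizedExp k (σ J) ≡ - sizedExp k J
  sizedExp-σ k J with lookup J a in J-a | lookup J s in J-s
  ... | false | true  = sizedExp-σ-flip k J J-a J-s
  ... | true  | false = begin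
    sizedExp k (σ J)          ≡⟨ neg-involutive _ ⟨
    - - sizedExp k (σ J)      ≡⟨ cong -_ (sizedExp-σ-flip k (σ J) σJ-a σJ-s) ⟨
    - sizedExp k (σ (σ J))    ≡⟨ cong (λ X → - sizedExp k X) (swap-involutive a s J) ⟩
    - sizedExp k J            ∎
    where
    open ≡-Reasoning
    σJ-a : lookup (σ J) a ≡ false
    σJ-a = trans (lookup-σ-a J) J-s
    σJ-s : lookup (σ J) s ≡ true
    σJ-s = trans (lookup-σ-s J) J-a
  ... | true  | true  = sizedExp-σ-fixed k J (trans J-a (sym J-s))
  ... | false | false = sizedExp-σ-fixed k J (trans J-a (sym J-s))

  prodExp≡0 : ∀ k → prodExp n k M ≡ + 0
  prodExp≡0 k = x≡-x⇒x≡0 (begin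
    prodExp n k M                           ≡⟨ ∑-filterᵇ _ _ subsets ⟩
    ∑ (sizedExp k) subsets                  ≡⟨ ∑-reindex (≡-dec _≟ᵇ_) (allSubsets-unique n) ∈-allSubsets
                                                         σ σ σ∘σ σ∘σ (sizedExp k) ⟨
    ∑ (sizedExp k ∘ σ) subsets              ≡⟨ ∑-cong (sizedExp-σ k) subsets ⟩
    ∑ (λ J → - sizedExp k J) subsets        ≡⟨ ∑-neg (sizedExp k) subsets ⟩
    - ∑ (sizedExp k) subsets                ≡⟨ cong -_ (∑-filterᵇ _ _ subsets) ⟨
    - prodExp n k M                         ∎)
    where
    open ≡-Reasoning
    subsets : List (Subset n)
    subsets = allSubsets n
    σ∘σ : ∀ J → σ (σ J) ≡ J
    σ∘σ = swap-involutive a s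

mainTheorem10 : (n k : ℕ) → 2 ≤ k → k < n →
    (M : Subset n) → ∣ M ∣ ≡ k → prodExp n k M ≡ + 0
mainTheorem10 zero    k _   ()  M _
mainTheorem10 (suc m) k 2≤k k<n M ∣M∣≡k =
  let s , s∈M , s-1∉M = ∃-risingEdge M not-full not-empty in Cancellation.prodExp≡0 M s s∈M s-1∉M k
  where
  open ≤-Reasoning
  not-full : ¬ (∀ i → lookup M i ≡ true)
  not-full full = <⇒≱ k<n (begin
    suc m         ≡⟨ ∣⊤∣≡n (suc m) ⟨
    ∣ ⊤ {suc m} ∣ ≤⟨ p⊆q⇒∣p∣≤∣q∣ {p = ⊤} {M} (λ {i} _ → lookup⇒[]= i M (full i)) ⟩
    ∣ M ∣         ≡⟨ ∣M∣≡k ⟩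
    k             ∎)
  empty⇒M⊆⊥ : (∀ i → lookup M i ≡ false) → M ⊆ ⊥
  empty⇒M⊆⊥ empty {i} i∈M = contradiction (trans (sym ([]=⇒lookup i∈M)) (empty i)) λ ()
  not-empty : ¬ (∀ i → lookup M i ≡ false)
  not-empty empty with () ← ≤-trans 2≤k (begin
    k             ≡⟨ ∣M∣≡k ⟨
    ∣ M ∣         ≤⟨ p⊆q⇒∣p∣≤∣q∣ {p = M} {⊥} (empty⇒M⊆⊥ empty) ⟩
    ∣ ⊥ {suc m} ∣ ≡⟨ ∣⊥∣≡0 (suc m) ⟩
    0             ∎)
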